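{- Let $(\sigma,\tau_0,\tau_1)\in S_3^3$. For every $n\ge1$ and every $(i_1,\ldots,i_n)\in\{0,1\}^n$, the area of $\Gamma_{(\sigma,\tau_0,\tau_1)}(i_1,\ldots,i_n)$ is half the area of $\Gamma_{(\sigma,\tau_0,\tau_1)}(i_1,\ldots,i_{n-1})$ (where for $n=1$ the latter is the closed triangle $\pi(V)$ with vertices $(0,0),(1,0),(1,1)$).
   Context: $\pi(x,y,z)=(y/x,z/x)$, and for a $3\times3$ matrix $M$ with nonzero first-row entries $\pi(M)$ is the closed triangle whose vertices are the $\pi$-images of the columns of $M$. $V=\begin{pmatrix}1&1&1\\0&1&1\\0&0&1\end{pmatrix}$, $G_0=\begin{pmatrix}0&0&1/2\\1&0&0\\0&1&1/2\end{pmatrix}$, $G_1=\begin{pmatrix}1&0&1/2\\0&1&0\\0&0&1/2\end{pmatrix}$. Elements of $S_3$ are identified with $3\times3$ permutation matrices. For $(\sigma,\tau_0,\tau_1)\in S_3^3$, $G_i(\sigma,\tau_0,\tau_1)=\sigma G_i\tau_i$ and $\Gamma_{(\sigma,\tau_0,\tau_1)}(i_1,\ldots,i_n)=\pi(VG_{i_1}(\sigma,\tau_0,\tau_1)\cdots G_{i_n}(\sigma,\tau_0,\tau_1))$. -}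

module Defs where

open import Data.Nat using (ℕ; zero; suc)
open import Data.Fin using (Fin; zero; suc)
import Data.Fin as Fin
open import Data.Fin.Permutation using (Permutation′; _⟨$⟩ʳ_)
open import Data.Rational using (ℚ; 0ℚ; 1ℚ; ½; _+_; _*_; _-_; _÷_; ∣_∣; ≢-nonZero)
open import Data.Rational.Properties using (_≟_)
open import Data.Product using (_×_; _,_)
open import Data.Vec using (Vec; []; _∷_)
open import Relation.Nullary using (yes; no)

-- 3×3 rational matrices, M i j = entry in row i, column j (indices 0,1,2)
Mat3 : Set
Mat3 = Fin 3 → Fin 3 → ℚ

_⊗_ : Mat3 → Mat3 → Mat3
(A ⊗ B) i j = A i zero * B zero j + A i (suc zero) * B (suc zero) j
              + A i (suc (suc zero)) * B (suc (suc zero)) j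

mat : ℚ → ℚ → ℚ → ℚ → ℚ → ℚ → ℚ → ℚ → ℚ → Mat3
mat a b c d e f g h k zero zero = a
mat a b c d e f g h k zero (suc zero) = b
mat a b c d e f g h k zero (suc (suc zero)) = c
mat a b c d e f g h k (suc zero) zero = d
mat a b c d e f g h k (suc zero) (suc zero) = e
mat a b c d e f g h k (suc zero) (suc (suc zero)) = f
mat a b c d e f g h k (suc (suc zero)) zero = g
mat a b c d e f g h k (suc (suc zero)) (suc zero) = h
mat a b c d e f g h k (suc (suc zero)) (suc (suc zero)) = k

V : Mat3
V = mat 1ℚ 1ℚ 1ℚ  0ℚ 1ℚ 1ℚ  0ℚ 0ℚ 1ℚ

G₀ : Mat3
G₀ = mat 0ℚ 0ℚ ½  1ℚ 0ℚ 0ℚ  0ℚ 1ℚ ½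

G₁ : Mat3
G₁ = mat 1ℚ 0ℚ ½  0ℚ 1ℚ 0ℚ  0ℚ 0ℚ ½

-- S₃ = permutations of Fin 3; permutation matrix sends e_j to e_{σ j}
S₃ : Set
S₃ = Permutation′ 3

permMat : S₃ → Mat3
permMat σ i j with i Fin.≟ (σ ⟨$⟩ʳ j)
... | yes _ = 1ℚ
... | no  _ = 0ℚ

G : S₃ → S₃ → S₃ → Fin 2 → Mat3
G σ τ₀ τ₁ zero = (permMat σ ⊗ G₀) ⊗ permMat τ₀
G σ τ₀ τ₁ (suc zero) = (permMat σ ⊗ G₁) ⊗ permMat τ₁

I₃ : Mat3
I₃ = mat 1ℚ 0ℚ 0ℚ  0ℚ 1ℚ 0ℚ  0ℚ 0ℚ 1ℚ

prodG : S₃ → S₃ → S₃ → {n : ℕ} → Vec (Fin 2) n → Mat3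
prodG σ τ₀ τ₁ [] = I₃
prodG σ τ₀ τ₁ (i ∷ w) = G σ τ₀ τ₁ i ⊗ prodG σ τ₀ τ₁ w

prodWord : S₃ → S₃ → S₃ → {n : ℕ} → Vec (Fin 2) n → Mat3
prodWord σ τ₀ τ₁ w = V ⊗ prodG σ τ₀ τ₁ w

-- y / x (junk value 0 when x = 0; never used, since first rows are nonzero)
divQ : ℚ → ℚ → ℚ
divQ y x with x ≟ 0ℚ
... | yes _ = 0ℚ
... | no x≢0 = _÷_ y x {{≢-nonZero x≢0}}

Point : Set
Point = ℚ × ℚ

πcol : Mat3 → Fin 3 → Point
πcol M j = divQ (M (suc zero) j) (M zero j) , divQ (M (suc (suc zero)) j) (M zero j)

triArea : Point → Point → Point → ℚ
triArea (ax , ay) (bx , by) (cx , cy) =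
  ½ * ∣ (bx - ax) * (cy - ay) - (cx - ax) * (by - ay) ∣

areaπ : Mat3 → ℚ
areaπ M = triArea (πcol M zero) (πcol M (suc zero)) (πcol M (suc (suc zero)))

-- Because every column of G₀, G₁ and of a permutation matrix sums to 1, right
-- multiplication by any G_i(σ,τ₀,τ₁) keeps the first row of V G_{i₁}⋯G_{iₙ} equal to
-- (1,1,1). For such a matrix M the points π(M) are just its lower two rows, so the
-- shoelace formula reads area π(M) = ½ |det M|. Since permutation matrices have
-- determinant ±1 and det G₀ = det G₁ = ½, multiplicativity of det gives
-- |det G_i(σ,τ₀,τ₁)| = ½, and appending one letter to the word halves the area.

module Submission where

open import Defs
open import Data.Nat using (ℕ)
open import Data.Fin using (Fin)
open import Data.Fin.Patterns using (0F; 1F; 2F)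
import Data.Fin.Properties as Fin
open import Data.Fin.Permutation using (_⟨$⟩ʳ_)
open import Data.Vec using (Vec; []; _∷_; _∷ʳ_)
open import Data.Rational using (ℚ; 0ℚ; 1ℚ; ½; _+_; _*_; _-_; ∣_∣)
open import Data.Rational.Properties
  using (+-*-commutativeRing; _≟_; *-identityˡ; *-identityʳ; *-comm; *-assoc; ∣p*q∣≡∣p∣*∣q∣)
open import Function.Bundles using (Injection)
open import Function.Definitions using (Injective)
open import Function.Properties.Inverse using (↔⇒↣)
open import Relation.Nullary using (yes; no)
open import Relation.Nullary.Decidable.Core using (dec⇒maybe)
open import Relation.Binary.PropositionalEquality
import Tactic.RingSolver.Core.AlmostCommutativeRing as ACR
open import Tactic.RingSolver using (solve-∀)

ring : ACR.AlmostCommutativeRing _ _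
ring = ACR.fromCommutativeRing +-*-commutativeRing (λ x → dec⇒maybe (0ℚ ≟ x))

det : Mat3 → ℚ
det M = M 0F 0F * (M 1F 1F * M 2F 2F - M 1F 2F * M 2F 1F)
      - M 0F 1F * (M 1F 0F * M 2F 2F - M 1F 2F * M 2F 0F)
      + M 0F 2F * (M 1F 0F * M 2F 1F - M 1F 1F * M 2F 0F)

det-cong : ∀ {A B} → (∀ i j → A i j ≡ B i j) → det A ≡ det B
det-cong A≈B
  rewrite A≈B 0F 0F | A≈B 0F 1F | A≈B 0F 2F
        | A≈B 1F 0F | A≈B 1F 1F | A≈B 1F 2F
        | A≈B 2F 0F | A≈B 2F 1F | A≈B 2F 2F = refl

det-⊗ : ∀ A B → det (A ⊗ B) ≡ det A * det B
det-⊗ A B =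
  identity (A 0F 0F) (A 0F 1F) (A 0F 2F) (A 1F 0F) (A 1F 1F) (A 1F 2F) (A 2F 0F) (A 2F 1F) (A 2F 2F)
           (B 0F 0F) (B 0F 1F) (B 0F 2F) (B 1F 0F) (B 1F 1F) (B 1F 2F) (B 2F 0F) (B 2F 1F) (B 2F 2F)
  where
  identity : ∀ a b c d e f g h k a′ b′ c′ d′ e′ f′ g′ h′ k′ →
    -- D is det spelled out, so that the ring solver sees a polynomial identity
    let D : ℚ → ℚ → ℚ → ℚ → ℚ → ℚ → ℚ → ℚ → ℚ → ℚ
        D a b c d e f g h k = a * (e * k - f * h) - b * (d * k - f * g) + c * (d * h - e * g)
    in D (a * a′ + b * d′ + c * g′) (a * b′ + b * e′ + c * h′) (a * c′ + b * f′ + c * k′)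
         (d * a′ + e * d′ + f * g′) (d * b′ + e * e′ + f * h′) (d * c′ + e * f′ + f * k′)
         (g * a′ + h * d′ + k * g′) (g * b′ + h * e′ + k * h′) (g * c′ + h * f′ + k * k′)
       ≡ D a b c d e f g h k * D a′ b′ c′ d′ e′ f′ g′ h′ k′
  identity = solve-∀ ring

columnSum : Mat3 → Fin 3 → ℚ
columnSum A j = A 0F j + A 1F j + A 2F j

ColumnSumsOne : Mat3 → Set
ColumnSumsOne A = ∀ j → columnSum A j ≡ 1ℚ

FirstRowOnes : Mat3 → Set
FirstRowOnes M = ∀ j → M 0F j ≡ 1ℚ

unitWeights⇒columnSum : ∀ {x y z} B j → x ≡ 1ℚ → y ≡ 1ℚ → z ≡ 1ℚ →
  x * B 0F j + y * B 1F j + z * B 2F j ≡ columnSum B j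
unitWeights⇒columnSum B j refl refl refl = identity (B 0F j) (B 1F j) (B 2F j)
  where
  identity : ∀ a b c → 1ℚ * a + 1ℚ * b + 1ℚ * c ≡ a + b + c
  identity = solve-∀ ring

⊗-firstRowOnes : ∀ M B → FirstRowOnes M → ColumnSumsOne B → FirstRowOnes (M ⊗ B)
⊗-firstRowOnes M B hM hB j = trans (unitWeights⇒columnSum B j (hM 0F) (hM 1F) (hM 2F)) (hB j)

columnSum-⊗ : ∀ A B j → columnSum (A ⊗ B) j
  ≡ columnSum A 0F * B 0F j + columnSum A 1F * B 1F j + columnSum A 2F * B 2F j
columnSum-⊗ A B j = identity (A 0F 0F) (A 0F 1F) (A 0F 2F) (A 1F 0F) (A 1F 1F) (A 1F 2F)
                             (A 2F 0F) (A 2F 1F) (A 2F 2F) (B 0F j) (B 1F j) (B 2F j)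
  where
  identity : ∀ a b c d e f g h k x y z →
    (a * x + b * y + c * z) + (d * x + e * y + f * z) + (g * x + h * y + k * z)
      ≡ (a + d + g) * x + (b + e + h) * y + (c + f + k) * z
  identity = solve-∀ ring

⊗-columnSumsOne : ∀ A B → ColumnSumsOne A → ColumnSumsOne B → ColumnSumsOne (A ⊗ B)
⊗-columnSumsOne A B hA hB j = begin
  columnSum (A ⊗ B) j
    ≡⟨ columnSum-⊗ A B j ⟩
  columnSum A 0F * B 0F j + columnSum A 1F * B 1F j + columnSum A 2F * B 2F j
    ≡⟨ unitWeights⇒columnSum B j (hA 0F) (hA 1F) (hA 2F) ⟩
  columnSum B j
    ≡⟨ hB j ⟩
  1ℚ ∎
  where open ≡-Reasoning

areaπ-firstRowOnes : ∀ M → FirstRowOnes M → areaπ M ≡ ½ * ∣ det M ∣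
areaπ-firstRowOnes M hM
  rewrite hM 0F | hM 1F | hM 2F
        -- once the first row is 1ℚ, each divQ y 1ℚ computes to y * 1ℚ
        | *-identityʳ (M 1F 0F) | *-identityʳ (M 1F 1F) | *-identityʳ (M 1F 2F)
        | *-identityʳ (M 2F 0F) | *-identityʳ (M 2F 1F) | *-identityʳ (M 2F 2F)
  = cong (λ x → ½ * ∣ x ∣) (identity (M 1F 0F) (M 1F 1F) (M 1F 2F) (M 2F 0F) (M 2F 1F) (M 2F 2F))
  where
  identity : ∀ d e f g h k → (e - d) * (k - g) - (f - d) * (h - g)
    ≡ 1ℚ * (e * k - f * h) - 1ℚ * (d * k - f * g) + 1ℚ * (d * h - e * g)
  identity = solve-∀ ring

unitVector : Fin 3 → Fin 3 → ℚ
unitVector k i with i Fin.≟ k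
... | yes _ = 1ℚ
... | no  _ = 0ℚ

unitColumns : (Fin 3 → Fin 3) → Mat3
unitColumns f i j = unitVector (f j) i

unitColumns-columnSumsOne : ∀ f → ColumnSumsOne (unitColumns f)
unitColumns-columnSumsOne f j with f j
... | 0F = refl
... | 1F = refl
... | 2F = refl

∣det-unitColumns∣ : ∀ f → Injective _≡_ _≡_ f → ∣ det (unitColumns f) ∣ ≡ 1ℚ
∣det-unitColumns∣ f f-inj with f 0F in e₀ | f 1F in e₁ | f 2F in e₂
... | 0F | 1F | 2F = refl
... | 0F | 2F | 1F = refl
... | 1F | 0F | 2F = refl
... | 1F | 2F | 0F = refl
... | 2F | 0F | 1F = refl
... | 2F | 1F | 0F = refl
... | 0F | 0F | _  with () ← f-inj (trans e₀ (sym e₁))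
... | 1F | 1F | _  with () ← f-inj (trans e₀ (sym e₁))
... | 2F | 2F | _  with () ← f-inj (trans e₀ (sym e₁))
... | 0F | _  | 0F with () ← f-inj (trans e₀ (sym e₂))
... | 1F | _  | 1F with () ← f-inj (trans e₀ (sym e₂))
... | 2F | _  | 2F with () ← f-inj (trans e₀ (sym e₂))
... | _  | 0F | 0F with () ← f-inj (trans e₁ (sym e₂))
... | _  | 1F | 1F with () ← f-inj (trans e₁ (sym e₂))
... | _  | 2F | 2F with () ← f-inj (trans e₁ (sym e₂))

permMat≡unitColumns : ∀ σ i j → permMat σ i j ≡ unitColumns (σ ⟨$⟩ʳ_) i j
permMat≡unitColumns σ i j with i Fin.≟ (σ ⟨$⟩ʳ j)
... | yes _ = refl
... | no  _ = refl

permMat-columnSumsOne : ∀ σ → ColumnSumsOne (permMat σ)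
permMat-columnSumsOne σ j
  rewrite permMat≡unitColumns σ 0F j | permMat≡unitColumns σ 1F j | permMat≡unitColumns σ 2F j
  = unitColumns-columnSumsOne (σ ⟨$⟩ʳ_) j

∣det-permMat∣ : ∀ σ → ∣ det (permMat σ) ∣ ≡ 1ℚ
∣det-permMat∣ σ = trans (cong ∣_∣ (det-cong (permMat≡unitColumns σ)))
                        (∣det-unitColumns∣ (σ ⟨$⟩ʳ_) (Injection.injective (↔⇒↣ σ)))

permuted-columnSumsOne : ∀ σ τ A →
  ColumnSumsOne A → ColumnSumsOne ((permMat σ ⊗ A) ⊗ permMat τ)
permuted-columnSumsOne σ τ A hA =
  ⊗-columnSumsOne (permMat σ ⊗ A) (permMat τ)
    (⊗-columnSumsOne (permMat σ) A (permMat-columnSumsOne σ) hA) (permMat-columnSumsOne τ)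

∣det-permuted∣ : ∀ σ τ A → ∣ det ((permMat σ ⊗ A) ⊗ permMat τ) ∣ ≡ ∣ det A ∣
∣det-permuted∣ σ τ A = begin
  ∣ det ((P ⊗ A) ⊗ Q) ∣           ≡⟨ cong ∣_∣ (det-⊗ (P ⊗ A) Q) ⟩
  ∣ det (P ⊗ A) * det Q ∣         ≡⟨ cong (λ x → ∣ x * det Q ∣) (det-⊗ P A) ⟩
  ∣ det P * det A * det Q ∣       ≡⟨ ∣p*q∣≡∣p∣*∣q∣ (det P * det A) (det Q) ⟩
  ∣ det P * det A ∣ * ∣ det Q ∣   ≡⟨ cong (_* ∣ det Q ∣) (∣p*q∣≡∣p∣*∣q∣ (det P) (det A)) ⟩
  ∣ det P ∣ * ∣ det A ∣ * ∣ det Q ∣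
    ≡⟨ cong₂ (λ x y → x * ∣ det A ∣ * y) (∣det-permMat∣ σ) (∣det-permMat∣ τ) ⟩
  1ℚ * ∣ det A ∣ * 1ℚ             ≡⟨ identity ∣ det A ∣ ⟩
  ∣ det A ∣                       ∎
  where
  open ≡-Reasoning
  P Q : Mat3
  P = permMat σ
  Q = permMat τ
  identity : ∀ x → 1ℚ * x * 1ℚ ≡ x
  identity = solve-∀ ring

G-columnSumsOne : ∀ σ τ₀ τ₁ i → ColumnSumsOne (G σ τ₀ τ₁ i)
G-columnSumsOne σ τ₀ τ₁ 0F = permuted-columnSumsOne σ τ₀ G₀ G₀-columnSumsOne
  where
  G₀-columnSumsOne : ColumnSumsOne G₀
  G₀-columnSumsOne 0F = refl
  G₀-columnSumsOne 1F = refl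
  G₀-columnSumsOne 2F = refl
G-columnSumsOne σ τ₀ τ₁ 1F = permuted-columnSumsOne σ τ₁ G₁ G₁-columnSumsOne
  where
  G₁-columnSumsOne : ColumnSumsOne G₁
  G₁-columnSumsOne 0F = refl
  G₁-columnSumsOne 1F = refl
  G₁-columnSumsOne 2F = refl

∣det-G∣ : ∀ σ τ₀ τ₁ i → ∣ det (G σ τ₀ τ₁ i) ∣ ≡ ½
∣det-G∣ σ τ₀ τ₁ 0F = ∣det-permuted∣ σ τ₀ G₀
∣det-G∣ σ τ₀ τ₁ 1F = ∣det-permuted∣ σ τ₁ G₁

module _ (σ τ₀ τ₁ : S₃) where

  private
    Gᵢ : Fin 2 → Mat3
    Gᵢ = G σ τ₀ τ₁

    P : ∀ {n} → Vec (Fin 2) n → Mat3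
    P = prodG σ τ₀ τ₁

  prodG-columnSumsOne : ∀ {n} (w : Vec (Fin 2) n) → ColumnSumsOne (P w)
  prodG-columnSumsOne [] = I₃-columnSumsOne
    where
    I₃-columnSumsOne : ColumnSumsOne I₃
    I₃-columnSumsOne 0F = refl
    I₃-columnSumsOne 1F = refl
    I₃-columnSumsOne 2F = refl
  prodG-columnSumsOne (i ∷ w) =
    ⊗-columnSumsOne (Gᵢ i) (P w) (G-columnSumsOne σ τ₀ τ₁ i) (prodG-columnSumsOne w)

  areaπ-prodWord : ∀ {n} (w : Vec (Fin 2) n) → areaπ (prodWord σ τ₀ τ₁ w) ≡ ½ * ∣ det (P w) ∣
  areaπ-prodWord w = begin
    areaπ (V ⊗ P w)         ≡⟨ areaπ-firstRowOnes (V ⊗ P w) V⊗P-firstRowOnes ⟩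
    ½ * ∣ det (V ⊗ P w) ∣   ≡⟨ cong (λ x → ½ * ∣ x ∣) (det-⊗ V (P w)) ⟩
    ½ * ∣ 1ℚ * det (P w) ∣  ≡⟨ cong (λ x → ½ * ∣ x ∣) (*-identityˡ (det (P w))) ⟩
    ½ * ∣ det (P w) ∣       ∎
    where
    open ≡-Reasoning
    V-firstRowOnes : FirstRowOnes V
    V-firstRowOnes 0F = refl
    V-firstRowOnes 1F = refl
    V-firstRowOnes 2F = refl
    V⊗P-firstRowOnes : FirstRowOnes (V ⊗ P w)
    V⊗P-firstRowOnes = ⊗-firstRowOnes V (P w) V-firstRowOnes (prodG-columnSumsOne w)

  det-prodG-∷ʳ : ∀ {n} (w : Vec (Fin 2) n) i → det (P (w ∷ʳ i)) ≡ det (P w) * det (Gᵢ i)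
  det-prodG-∷ʳ [] i = begin
    det (Gᵢ i ⊗ I₃)   ≡⟨ det-⊗ (Gᵢ i) I₃ ⟩
    det (Gᵢ i) * 1ℚ   ≡⟨ *-comm (det (Gᵢ i)) 1ℚ ⟩
    1ℚ * det (Gᵢ i)   ∎
    where open ≡-Reasoning
  det-prodG-∷ʳ (j ∷ w) i = begin
    det (Gᵢ j ⊗ P (w ∷ʳ i))               ≡⟨ det-⊗ (Gᵢ j) (P (w ∷ʳ i)) ⟩
    det (Gᵢ j) * det (P (w ∷ʳ i))         ≡⟨ cong (det (Gᵢ j) *_) (det-prodG-∷ʳ w i) ⟩
    det (Gᵢ j) * (det (P w) * det (Gᵢ i)) ≡⟨ *-assoc (det (Gᵢ j)) (det (P w)) (det (Gᵢ i)) ⟨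
    det (Gᵢ j) * det (P w) * det (Gᵢ i)   ≡⟨ cong (_* det (Gᵢ i)) (det-⊗ (Gᵢ j) (P w)) ⟨
    det (Gᵢ j ⊗ P w) * det (Gᵢ i)         ∎
    where open ≡-Reasoning

  ∣det-prodG-∷ʳ∣ : ∀ {n} (w : Vec (Fin 2) n) i → ∣ det (P (w ∷ʳ i)) ∣ ≡ ½ * ∣ det (P w) ∣
  ∣det-prodG-∷ʳ∣ w i = begin
    ∣ det (P (w ∷ʳ i)) ∣          ≡⟨ cong ∣_∣ (det-prodG-∷ʳ w i) ⟩
    ∣ det (P w) * det (Gᵢ i) ∣    ≡⟨ ∣p*q∣≡∣p∣*∣q∣ (det (P w)) (det (Gᵢ i)) ⟩
    ∣ det (P w) ∣ * ∣ det (Gᵢ i) ∣ ≡⟨ cong (∣ det (P w) ∣ *_) (∣det-G∣ σ τ₀ τ₁ i) ⟩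
    ∣ det (P w) ∣ * ½             ≡⟨ *-comm ∣ det (P w) ∣ ½ ⟩
    ½ * ∣ det (P w) ∣             ∎
    where open ≡-Reasoning

mainTheorem9 : (σ τ₀ τ₁ : S₃) (n : ℕ) (w : Vec (Fin 2) n) (i : Fin 2) →
    areaπ (prodWord σ τ₀ τ₁ (w ∷ʳ i)) ≡ ½ * areaπ (prodWord σ τ₀ τ₁ w)
mainTheorem9 σ τ₀ τ₁ n w i = begin
  areaπ (prodWord σ τ₀ τ₁ (w ∷ʳ i))      ≡⟨ areaπ-prodWord σ τ₀ τ₁ (w ∷ʳ i) ⟩
  ½ * ∣ det (prodG σ τ₀ τ₁ (w ∷ʳ i)) ∣   ≡⟨ cong (½ *_) (∣det-prodG-∷ʳ∣ σ τ₀ τ₁ w i) ⟩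
  ½ * (½ * ∣ det (prodG σ τ₀ τ₁ w) ∣)    ≡⟨ cong (½ *_) (areaπ-prodWord σ τ₀ τ₁ w) ⟨
  ½ * areaπ (prodWord σ τ₀ τ₁ w)         ∎
  where open ≡-Reasoning
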